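{- Let $\Gamma,\Delta$ be finite sets of formulas in $For_2$ with $\Gamma\cup\Delta$ nonempty. If the sequent $\Gamma\Rightarrow\Delta$ is provable in $\mathbf{B}$, then there is a derivation of it in $\mathbf{B}$ that does not use the Cut rule.
   Context: Fix a denumerable set $prop$ of propositional variables. $For_2$ is the set of formulas built from $prop$ with a unary connective $\lnot$ and a binary connective $\wedge$. $var(\alpha)$ is the set of propositional variables in $\alpha$; $var(\Gamma)=\bigcup_{\gamma\in\Gamma}var(\gamma)$. A sequent $\Gamma\Rightarrow\Delta$ is an ordered pair of finite sets of formulas, not both empty; $\alpha,\Gamma$ denotes $\Gamma\cup\{\alpha\}$. The calculus $\mathbf{B}$ has the axiom $\alpha\Rightarrow\alpha$ and the rules (premises / conclusion): (W$\Rightarrow$) $\Gamma\Rightarrow\Delta$ / $\alpha,\Gamma\Rightarrow\Delta$; ($\Rightarrow$W) $\Gamma\Rightarrow\Delta$ / $\Gamma\Rightarrow\Delta,\alpha$; (Cut) $\Gamma\Rightarrow\Delta,\alpha$ and $\alpha,\Gamma\Rightarrow\Delta$ / $\Gamma\Rightarrow\Delta$; ($\lnot\Rightarrow$) $\Gamma\Rightarrow\Delta,\alpha$ / $\lnot\alpha,\Gamma\Rightarrow\Delta$; ($\Rightarrow\lnot^B$) $\alpha,\Gamma\Rightarrow\Delta$ / $\Gamma\Rightarrow\Delta,\lnot\alpha$, allowed only if $var(\alpha)\subseteq var(\Gamma)$; ($\wedge\Rightarrow$) $\alpha_1,\alpha_2,\Gamma\Rightarrow\Delta$ / $\alpha_1\wedge\alpha_2,\Gamma\Rightarrow\Delta$;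 ($\Rightarrow\wedge$) $\Gamma\Rightarrow\Delta,\alpha_1$ and $\Gamma\Rightarrow\Delta,\alpha_2$ / $\Gamma\Rightarrow\Delta,\alpha_1\wedge\alpha_2$. -}

module Defs where

open import Data.Nat using (ℕ)
open import Data.Bool using (Bool; true; false)
open import Data.List using (List; []; _∷_; _++_; concatMap)
open import Data.List.Membership.Propositional using (_∈_)
open import Data.Product using (_×_)
open import Data.Sum using (_⊎_)
open import Relation.Nullary using (¬_)
open import Relation.Binary.PropositionalEquality using (_≡_)

Prop : Set
Prop = ℕ

data Formula : Set where
  var : Prop → Formula
  ¬'  : Formula → Formula
  _∧'_ : Formula → Formula → Formula

vars : Formula → List Prop
vars (var p)   = p ∷ []
vars (¬' a)    = vars a
vars (a ∧' b)  = vars a ++ vars b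

varsL : List Formula → List Prop
varsL = concatMap vars

-- Finite sets of formulas are represented by lists, compared up to
-- having the same elements (order and multiplicity irrelevant).
_⊆_ : List Formula → List Formula → Set
X ⊆ Y = ∀ {a} → a ∈ X → a ∈ Y

_≈_ : List Formula → List Formula → Set
X ≈ Y = (X ⊆ Y) × (Y ⊆ X)

_⊆ᵛ_ : List Prop → List Prop → Set
X ⊆ᵛ Y = ∀ {p} → p ∈ X → p ∈ Y

NonEmptySeq : List Formula → List Formula → Set
NonEmptySeq Γ Δ = ¬ (Γ ≡ [] × Δ ≡ [])

-- The Bool index records whether Cut may be used
-- (true = Cut allowed; false = cut-free).  Each rule's conclusion is
-- given as arbitrary lists that are set-equal to the intended
-- conclusion, so that "α,Γ" means Γ ∪ {α}.
data ⊢[_]_⇒_ (c : Bool) : List Formula → List Formula → Set where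
  ax  : ∀ {a Γ Δ} → Γ ≈ (a ∷ []) → Δ ≈ (a ∷ []) → ⊢[ c ] Γ ⇒ Δ
  wl  : ∀ {a Γ Δ Γ'} → ⊢[ c ] Γ ⇒ Δ → Γ' ≈ (a ∷ Γ) → ⊢[ c ] Γ' ⇒ Δ
  wr  : ∀ {a Γ Δ Δ'} → ⊢[ c ] Γ ⇒ Δ → Δ' ≈ (a ∷ Δ) → ⊢[ c ] Γ ⇒ Δ'
  cut : ∀ {a Γ Δ Γ₁ Δ₁ Γ₂ Δ₂} → c ≡ true → NonEmptySeq Γ Δ →
        ⊢[ c ] Γ₁ ⇒ Δ₁ → Γ₁ ≈ Γ → Δ₁ ≈ (a ∷ Δ) →
        ⊢[ c ] Γ₂ ⇒ Δ₂ → Γ₂ ≈ (a ∷ Γ) → Δ₂ ≈ Δ →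
        ⊢[ c ] Γ ⇒ Δ
  ¬l  : ∀ {a Γ Δ Γ' Δ₁} → ⊢[ c ] Γ ⇒ Δ₁ → Δ₁ ≈ (a ∷ Δ) → Γ' ≈ (¬' a ∷ Γ) →
        ⊢[ c ] Γ' ⇒ Δ
  ¬rB : ∀ {a Γ Δ Γ₁ Δ'} → ⊢[ c ] Γ₁ ⇒ Δ → Γ₁ ≈ (a ∷ Γ) → Δ' ≈ (¬' a ∷ Δ) →
        vars a ⊆ᵛ varsL Γ →
        ⊢[ c ] Γ ⇒ Δ'
  ∧l  : ∀ {a b Γ Δ Γ₁ Γ'} → ⊢[ c ] Γ₁ ⇒ Δ → Γ₁ ≈ (a ∷ b ∷ Γ) →
        Γ' ≈ ((a ∧' b) ∷ Γ) → ⊢[ c ] Γ' ⇒ Δ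
  ∧r  : ∀ {a b Γ Δ Δ₁ Δ₂ Δ'} → ⊢[ c ] Γ ⇒ Δ₁ → Δ₁ ≈ (a ∷ Δ) →
        ⊢[ c ] Γ ⇒ Δ₂ → Δ₂ ≈ (b ∷ Δ) → Δ' ≈ ((a ∧' b) ∷ Δ) →
        ⊢[ c ] Γ ⇒ Δ'

-- B is sound for weak Kleene three-valued semantics, in which the third
-- value "undefined" is infectious and only `true` is designated: a
-- valuation making all of Γ true and nothing in Δ true refutes every
-- derivation of Γ ⇒ Δ, with or without Cut (`sound`).  Conversely, a
-- terminating backward proof search using only the cut-free rules (`search`)
-- returns either a cut-free derivation of Γ ⇒ Δ or such a falsifying
-- valuation, defined exactly on the variables of Γ.  Each rule step turns
-- countermodels of its premises into one of its conclusion; the variable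
-- restriction of (⇒¬) is matched by the domain of the valuation: a negation
-- ¬a on the right with a variable outside Γ is weakened away, since then a
-- is undefined.  A derivation with Cut therefore excludes the countermodel,
-- so the search yields a cut-free derivation (`mainTheorem6`).
module Submission where

open import Defs
open import Data.Bool using (Bool; true; false; not; _∧_)
open import Data.Empty using (⊥; ⊥-elim)
open import Data.List using (List; []; _∷_; _++_; map; [_])
open import Data.List.Properties using (++-assoc; ++-identityʳ)
open import Data.List.Membership.Propositional using (_∈_; _∉_; find; lose)
open import Data.List.Membership.Propositional.Properties
  using (∈-++⁺ˡ; ∈-++⁺ʳ; ∈-++⁻; ∈-map⁺; ∈-map⁻; ∈-concatMap⁺; ∈-concatMap⁻)
open import Data.List.Relation.Unary.Any using (here; there; any?)
open import Data.List.Relation.Unary.All using (all?)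
import Data.List.Relation.Unary.All as All
open import Data.List.Relation.Unary.All.Properties using (¬All⇒Any¬)
import Data.List.Relation.Binary.Permutation.Propositional as Perm
import Data.List.Relation.Binary.Permutation.Propositional.Properties as Perm
open import Data.Maybe using (Maybe; just; nothing; zipWith)
import Data.Maybe as Maybe
open import Data.Maybe.Properties using (≡-dec)
import Data.Bool.Properties as Bool
open import Data.Nat using (ℕ; suc; _+_; _<_; s≤s)
open import Data.Nat.Properties
  using (_≟_; +-assoc; +-comm; +-monoˡ-≤; m≤m+n; m≤n+m; n<1+n; ≤-reflexive; ≤-pred; <-≤-trans)
open import Data.Product using (Σ; ∃; _×_; _,_; proj₁; proj₂)
open import Data.Sum using (_⊎_; inj₁; inj₂; [_,_]′)
open import Relation.Nullary using (¬_; Dec; yes; no)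
open import Relation.Binary.PropositionalEquality
  using (_≡_; refl; sym; trans; cong; subst; subst₂; module ≡-Reasoning)
open import Data.List.Membership.DecPropositional _≟_ using (_∈?_)

≈-refl : ∀ {X} → X ≈ X
≈-refl = (λ m → m) , (λ m → m)

≈-sym : ∀ {X Y} → X ≈ Y → Y ≈ X
≈-sym (f , g) = g , f

≈-trans : ∀ {X Y Z} → X ≈ Y → Y ≈ Z → X ≈ Z
≈-trans (f , g) (h , k) = (λ m → h (f m)) , (λ m → g (k m))

∷-cong : ∀ {a X Y} → X ≈ Y → (a ∷ X) ≈ (a ∷ Y)
∷-cong (f , g) = cong-⊆ f , cong-⊆ g
  where
  cong-⊆ : ∀ {a X Y} → X ⊆ Y → (a ∷ X) ⊆ (a ∷ Y)
  cong-⊆ s (here eq) = here eq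
  cong-⊆ s (there m) = there (s m)

↭⇒≈ : ∀ {X Y} → X Perm.↭ Y → X ≈ Y
↭⇒≈ p = Perm.∈-resp-↭ p , Perm.∈-resp-↭ (Perm.↭-sym p)

shift : ∀ X {a Y} → (X ++ a ∷ Y) ≈ (a ∷ X ++ Y)
shift X {a} {Y} = ↭⇒≈ (Perm.shift a X Y)

shift₂ : ∀ X Y {a Z} → (X ++ Y ++ a ∷ Z) ≈ (a ∷ X ++ Y ++ Z)
shift₂ X Y {a} {Z} =
  ↭⇒≈ (Perm.↭-trans (Perm.++⁺ˡ X (Perm.shift a Y Z)) (Perm.shift a X (Y ++ Z)))

absorb : ∀ {a X} → a ∈ X → X ≈ (a ∷ X)
absorb a∈X = there , λ { (here refl) → a∈X ; (there m) → m }

absorb-++ : ∀ {X Y} → Y ⊆ X → (X ++ Y) ≈ X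
absorb-++ {X} Y⊆X = (λ m → [ (λ m' → m') , Y⊆X ]′ (∈-++⁻ X m)) , ∈-++⁺ˡ

⊆[]⇒≡[] : ∀ {X} → X ⊆ [] → X ≡ []
⊆[]⇒≡[] {[]}    s = refl
⊆[]⇒≡[] {x ∷ X} s with s (here refl)
... | ()

singleton-⊆ : ∀ {a X} → a ∈ X → [ a ] ⊆ X
singleton-⊆ a∈X (here refl) = a∈X

varsL⁻ : ∀ Γ {p} → p ∈ varsL Γ → ∃ λ g → g ∈ Γ × p ∈ vars g
varsL⁻ Γ m = find (∈-concatMap⁻ vars m)

varsL⁺ : ∀ {Γ g p} → g ∈ Γ → p ∈ vars g → p ∈ varsL Γ
varsL⁺ g∈Γ p∈g = ∈-concatMap⁺ vars (lose g∈Γ p∈g)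

varsL-mono : ∀ {Γ Γ'} → Γ ⊆ Γ' → varsL Γ ⊆ᵛ varsL Γ'
varsL-mono {Γ} s m with varsL⁻ Γ m
... | g , g∈Γ , p∈g = varsL⁺ (s g∈Γ) p∈g

⊆ᵛ-or-escapes : ∀ xs S → xs ⊆ᵛ S ⊎ ∃ λ p → p ∈ xs × p ∉ S
⊆ᵛ-or-escapes xs S with all? (_∈? S) xs
... | yes all∈ = inj₁ (All.lookup all∈)
... | no ¬all  = inj₂ (find (¬All⇒Any¬ (_∈? S) xs ¬all))

common-or-disjoint : ∀ B A → (∃ λ p → p ∈ B × p ∈ A) ⊎ (∀ {p} → p ∈ B → p ∉ A)
common-or-disjoint B A with any? (_∈? A) B
... | yes some = inj₁ (find some)
... | no none  = inj₂ λ p∈B p∈A → none (lose p∈B p∈A)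

nonEmpty-resp : ∀ {Γ Δ Γ' Δ'} → Γ ≈ Γ' → Δ ≈ Δ' → NonEmptySeq Γ Δ → NonEmptySeq Γ' Δ'
nonEmpty-resp (Γ⊆Γ' , _) (Δ⊆Δ' , _) ne (refl , refl) = ne (⊆[]⇒≡[] Γ⊆Γ' , ⊆[]⇒≡[] Δ⊆Δ')

transport : ∀ {c Γ Δ Γ' Δ'} → ⊢[ c ] Γ ⇒ Δ → Γ ≈ Γ' → Δ ≈ Δ' → ⊢[ c ] Γ' ⇒ Δ'
transport (ax Γ≈ Δ≈) e f = ax (≈-trans (≈-sym e) Γ≈) (≈-trans (≈-sym f) Δ≈)
transport (wl d Γ≈) e f = wl (transport d ≈-refl f) (≈-trans (≈-sym e) Γ≈)
transport (wr d Δ≈) e f = wr (transport d e ≈-refl) (≈-trans (≈-sym f) Δ≈)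
transport (cut c ne d₁ Γ₁≈ Δ₁≈ d₂ Γ₂≈ Δ₂≈) e f =
  cut c (nonEmpty-resp e f ne) d₁ (≈-trans Γ₁≈ e) (≈-trans Δ₁≈ (∷-cong f))
      d₂ (≈-trans Γ₂≈ (∷-cong e)) (≈-trans Δ₂≈ f)
transport (¬l d Δ₁≈ Γ≈) e f = ¬l d (≈-trans Δ₁≈ (∷-cong f)) (≈-trans (≈-sym e) Γ≈)
transport (¬rB d Γ₁≈ Δ≈ covered) e f =
  ¬rB d (≈-trans Γ₁≈ (∷-cong e)) (≈-trans (≈-sym f) Δ≈)
      (λ m → varsL-mono (proj₁ e) (covered m))
transport (∧l d Γ₁≈ Γ≈) e f = ∧l (transport d ≈-refl f) Γ₁≈ (≈-trans (≈-sym e) Γ≈)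
transport (∧r d₁ Δ₁≈ d₂ Δ₂≈ Δ≈) e f =
  ∧r (transport d₁ e ≈-refl) Δ₁≈ (transport d₂ e ≈-refl) Δ₂≈ (≈-trans (≈-sym f) Δ≈)

weaken : ∀ {c Γ Δ Γ' Δ'} → ⊢[ c ] Γ ⇒ Δ → Γ ⊆ Γ' → Δ ⊆ Δ' → ⊢[ c ] Γ' ⇒ Δ'
weaken {Γ' = Γ'} {Δ'} d Γ⊆Γ' Δ⊆Δ' =
  transport (weaken-right Δ' (weaken-left Γ' d)) (absorb-++ Γ⊆Γ') (absorb-++ Δ⊆Δ')
  where
  weaken-left : ∀ {c Γ Δ} E → ⊢[ c ] Γ ⇒ Δ → ⊢[ c ] (E ++ Γ) ⇒ Δ
  weaken-left []      d = d
  weaken-left (_ ∷ E) d = wl (weaken-left E d) ≈-refl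
  weaken-right : ∀ {c Γ Δ} E → ⊢[ c ] Γ ⇒ Δ → ⊢[ c ] Γ ⇒ (E ++ Δ)
  weaken-right []      d = d
  weaken-right (_ ∷ E) d = wr (weaken-right E d) ≈-refl

-- Weak Kleene semantics: `nothing` is the third, infectious value and only
-- `just true` is designated.

Valuation : Set
Valuation = Prop → Maybe Bool

eval : Valuation → Formula → Maybe Bool
eval v (var p)  = v p
eval v (¬' a)   = Maybe.map not (eval v a)
eval v (a ∧' b) = zipWith _∧_ (eval v a) (eval v b)

Sat : Valuation → Formula → Set
Sat v a = eval v a ≡ just true

sat? : ∀ v a → Dec (Sat v a)
sat? v a = ≡-dec Bool._≟_ (eval v a) (just true)

Defined : Valuation → Formula → Set
Defined v a = Σ Bool λ b → eval v a ≡ just b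

sat-∧⁻ : ∀ {v} a b → Sat v (a ∧' b) → Sat v a × Sat v b
sat-∧⁻ {v} a b s with eval v a | eval v b
sat-∧⁻ a b refl | just true  | just true = refl , refl
sat-∧⁻ a b ()   | just false | just _
sat-∧⁻ a b ()   | just true  | just false
sat-∧⁻ a b ()   | just _     | nothing
sat-∧⁻ a b ()   | nothing    | _

sat-∧⁺ : ∀ {v} a b → Sat v a → Sat v b → Sat v (a ∧' b)
sat-∧⁺ {v} a b sa sb rewrite sa | sb = refl

sat-¬⁺ : ∀ {v} a → eval v a ≡ just false → Sat v (¬' a)
sat-¬⁺ {v} a e rewrite e = refl

sat-¬-excl : ∀ {v} a → Sat v a → ¬ Sat v (¬' a)
sat-¬-excl {v} a s s¬ rewrite s with s¬
... | ()

undefined-not-sat : ∀ {v} a → eval v a ≡ nothing → ¬ Sat v a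
undefined-not-sat a e s with trans (sym e) s
... | ()

defined⁻ : ∀ v a → Defined v a → ∀ {p} → p ∈ vars a → Defined v (var p)
defined⁻ v (var q) def (here refl) = def
defined⁻ v (¬' a) (b , e) m with eval v a in ea
... | just x = defined⁻ v a (x , ea) m
defined⁻ v (a ∧' b) (_ , e) m with eval v a in ea | eval v b in eb | ∈-++⁻ (vars a) m
... | just x | just y | inj₁ m' = defined⁻ v a (x , ea) m'
... | just x | just y | inj₂ m' = defined⁻ v b (y , eb) m'

defined⁺ : ∀ v a → (∀ {p} → p ∈ vars a → Defined v (var p)) → Defined v a
defined⁺ v (var p) all = all (here refl)
defined⁺ v (¬' a) all with defined⁺ v a all
... | b , e rewrite e = not b , refl
defined⁺ v (a ∧' b) all
  with defined⁺ v a (λ m → all (∈-++⁺ˡ m)) | defined⁺ v b (λ m → all (∈-++⁺ʳ (vars a) m))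
... | x , ex | y , ey rewrite ex | ey = x ∧ y , refl

undefined⁺ : ∀ v a {p} → v p ≡ nothing → p ∈ vars a → eval v a ≡ nothing
undefined⁺ v (var q) e (here refl) = e
undefined⁺ v (¬' a) e m rewrite undefined⁺ v a e m = refl
undefined⁺ v (a ∧' b) e m with ∈-++⁻ (vars a) m
... | inj₁ m' rewrite undefined⁺ v a e m' = refl
... | inj₂ m' rewrite undefined⁺ v b e m' with eval v a
... | just _  = refl
... | nothing = refl

Holds : Valuation → List Formula → Set
Holds v Γ = ∀ {g} → g ∈ Γ → Sat v g

Fails : Valuation → List Formula → Set
Fails v Δ = ∀ {d} → d ∈ Δ → ¬ Sat v d

holds-∷ : ∀ {v a Γ} → Sat v a → Holds v Γ → Holds v (a ∷ Γ)
holds-∷ s h (here refl) = s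
holds-∷ s h (there m)   = h m

fails-∷ : ∀ {v a Δ} → ¬ Sat v a → Fails v Δ → Fails v (a ∷ Δ)
fails-∷ s f (here refl) = s
fails-∷ s f (there m)   = f m

holds-defined : ∀ v Γ → Holds v Γ → ∀ {p} → p ∈ varsL Γ → Defined v (var p)
holds-defined v Γ h m with varsL⁻ Γ m
... | g , g∈Γ , p∈g = defined⁻ v g (true , h g∈Γ) p∈g

sound : ∀ {c Γ Δ} → ⊢[ c ] Γ ⇒ Δ → (v : Valuation) → Holds v Γ → Fails v Δ → ⊥
sound (ax (_ , a∈Γ) (_ , a∈Δ)) v h f = f (a∈Δ (here refl)) (h (a∈Γ (here refl)))
sound (wl d (_ , Γ⊆)) v h f = sound d v (λ m → h (Γ⊆ (there m))) f
sound (wr d (_ , Δ⊆)) v h f = sound d v h (λ m → f (Δ⊆ (there m)))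
sound (cut {a} _ _ d₁ (Γ₁⊆ , _) (Δ₁⊆ , _) d₂ (Γ₂⊆ , _) (Δ₂⊆ , _)) v h f with sat? v a
... | yes sa = sound d₂ v (λ m → holds-∷ sa h (Γ₂⊆ m)) (λ m → f (Δ₂⊆ m))
... | no ¬sa = sound d₁ v (λ m → h (Γ₁⊆ m)) (λ m → fails-∷ ¬sa f (Δ₁⊆ m))
sound (¬l {a} d (Δ₁⊆ , _) (_ , Γ⊆)) v h f =
  sound d v (λ m → h (Γ⊆ (there m)))
    (λ m → fails-∷ (λ sa → sat-¬-excl a sa (h (Γ⊆ (here refl)))) f (Δ₁⊆ m))
sound (¬rB {a} {Γ} d (Γ₁⊆ , _) (_ , Δ⊆) covered) v h f
  with defined⁺ v a (λ m → holds-defined v Γ h (covered m))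
... | true  , e = sound d v (λ m → holds-∷ e h (Γ₁⊆ m)) (λ m → f (Δ⊆ (there m)))
... | false , e = f (Δ⊆ (here refl)) (sat-¬⁺ a e)
sound (∧l {a} {b} d (Γ₁⊆ , _) (_ , Γ⊆)) v h f with sat-∧⁻ a b (h (Γ⊆ (here refl)))
... | sa , sb = sound d v (λ m → holds-∷ sa (holds-∷ sb (λ m' → h (Γ⊆ (there m')))) (Γ₁⊆ m)) f
sound (∧r {a} {b} d₁ (Δ₁⊆ , _) d₂ (Δ₂⊆ , _) (_ , Δ⊆)) v h f with sat? v a
... | no ¬sa = sound d₁ v h (λ m → fails-∷ ¬sa (λ m' → f (Δ⊆ (there m'))) (Δ₁⊆ m))
... | yes sa = sound d₂ v h (λ m → fails-∷ ¬sb (λ m' → f (Δ⊆ (there m'))) (Δ₂⊆ m))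
  where
  ¬sb : ¬ Sat v b
  ¬sb sb = f (Δ⊆ (here refl)) (sat-∧⁺ a b sa sb)

-- During the search P is the part of
-- the antecedent already known to be true; S is the variable set of the
-- whole antecedent.
record Countermodel (P : List Formula) (S : List Prop) (Δ : List Formula) : Set where
  field
    val           : Valuation
    holds         : Holds val P
    fails         : Fails val Δ
    defined-on    : ∀ {p} → p ∈ S → Defined val (var p)
    undefined-off : ∀ {p} → p ∉ S → val p ≡ nothing
open Countermodel

refine : ∀ {P S Δ P' Δ'} (cm : Countermodel P S Δ) → Holds (val cm) P' → Fails (val cm) Δ' →
         Countermodel P' S Δ'
refine cm h f = record
  { val = val cm ; holds = h ; fails = f
  ; defined-on = defined-on cm ; undefined-off = undefined-off cm }

rescope : ∀ {P S Δ S'} → S ⊆ᵛ S' → S' ⊆ᵛ S → Countermodel P S Δ → Countermodel P S' Δ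
rescope S⊆ S'⊆ cm = record
  { val = val cm ; holds = holds cm ; fails = fails cm
  ; defined-on = λ m → defined-on cm (S'⊆ m)
  ; undefined-off = λ p∉S' → undefined-off cm (λ p∈S → p∉S' (S⊆ p∈S)) }

Outcome : List Formula → List Formula → List Formula → Set
Outcome P Γ Δ = ⊢[ false ] Γ ⇒ Δ ⊎ Countermodel P (varsL Γ) Δ

outcome-resp : ∀ {P Γ Δ P' Γ' Δ'} → P ≈ P' → Γ ≈ Γ' → Δ ≈ Δ' →
               Outcome P Γ Δ → Outcome P' Γ' Δ'
outcome-resp eP eΓ eΔ (inj₁ d)  = inj₁ (transport d eΓ eΔ)
outcome-resp eP eΓ eΔ (inj₂ cm) =
  inj₂ (rescope (varsL-mono (proj₁ eΓ)) (varsL-mono (proj₂ eΓ))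
          (refine cm (λ m → holds cm (proj₂ eP m)) (λ m → fails cm (proj₂ eΔ m))))

-- (¬⇒): if a is not true but its variables are defined, then ¬a is true.
neg-left : ∀ {a P Γ Δ} → ¬' a ∈ Γ → Outcome P Γ (a ∷ Δ) → Outcome (¬' a ∷ P) Γ Δ
neg-left ¬a∈Γ (inj₁ d) = inj₁ (¬l d ≈-refl (absorb ¬a∈Γ))
neg-left {a} ¬a∈Γ (inj₂ cm) = inj₂ (refine cm
  (holds-∷ (sat-¬ (defined⁺ (val cm) a (λ m → defined-on cm (varsL⁺ ¬a∈Γ m)))) (holds cm))
  (λ m → fails cm (there m)))
  where
  sat-¬ : Defined (val cm) a → Sat (val cm) (¬' a)
  sat-¬ (true  , e) = ⊥-elim (fails cm (here refl) e)
  sat-¬ (false , e) = sat-¬⁺ a e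

and-left : ∀ {a b P Γ Δ} → Outcome (a ∷ b ∷ P) (a ∷ b ∷ Γ) Δ →
           Outcome ((a ∧' b) ∷ P) ((a ∧' b) ∷ Γ) Δ
and-left (inj₁ d) = inj₁ (∧l d ≈-refl ≈-refl)
and-left {a} {b} {P} {Γ} {Δ} (inj₂ cm) =
  inj₂ (subst (λ S → Countermodel ((a ∧' b) ∷ P) S Δ) same-vars (refine cm
    (holds-∷ (sat-∧⁺ a b (holds cm (here refl)) (holds cm (there (here refl))))
             (λ m → holds cm (there (there m))))
    (fails cm)))
  where
  same-vars : varsL (a ∷ b ∷ Γ) ≡ varsL ((a ∧' b) ∷ Γ)
  same-vars = sym (++-assoc (vars a) (vars b) (varsL Γ))

-- (⇒¬) when var(a) ⊆ var(Γ): a true makes ¬a not true.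
neg-right-covered : ∀ {a P Γ Δ} → vars a ⊆ᵛ varsL Γ → Outcome (a ∷ P) (a ∷ Γ) Δ →
                    Outcome P Γ (¬' a ∷ Δ)
neg-right-covered covered (inj₁ d) = inj₁ (¬rB d ≈-refl ≈-refl covered)
neg-right-covered {a} {Γ = Γ} covered (inj₂ cm) =
  inj₂ (rescope from-a∷Γ (∈-++⁺ʳ (vars a)) (refine cm
    (λ m → holds cm (there m))
    (fails-∷ (sat-¬-excl a (holds cm (here refl))) (fails cm))))
  where
  from-a∷Γ : varsL (a ∷ Γ) ⊆ᵛ varsL Γ
  from-a∷Γ m with ∈-++⁻ (vars a) m
  ... | inj₁ p∈a = covered p∈a
  ... | inj₂ p∈Γ = p∈Γ

-- (⇒W) when some variable of a is absent from Γ: then a, hence ¬a, is undefined.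
neg-right-escaping : ∀ {a p P Γ Δ} → p ∈ vars a → p ∉ varsL Γ → Outcome P Γ Δ →
                     Outcome P Γ (¬' a ∷ Δ)
neg-right-escaping p∈a p∉Γ (inj₁ d) = inj₁ (wr d ≈-refl)
neg-right-escaping {a} p∈a p∉Γ (inj₂ cm) = inj₂ (refine cm (holds cm)
  (fails-∷ (undefined-not-sat (¬' a) (undefined⁺ (val cm) (¬' a) (undefined-off cm p∉Γ) p∈a))
           (fails cm)))

and-right : ∀ {a b P Γ Δ} → Outcome P Γ (a ∷ Δ) → Outcome P Γ (b ∷ Δ) →
            Outcome P Γ ((a ∧' b) ∷ Δ)
and-right (inj₁ d₁) (inj₁ d₂) = inj₁ (∧r d₁ ≈-refl d₂ ≈-refl ≈-refl)
and-right {a} {b} (inj₂ cm) _ = inj₂ (refine cm (holds cm)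
  (fails-∷ (λ s → fails cm (here refl) (proj₁ (sat-∧⁻ a b s))) (λ m → fails cm (there m))))
and-right {a} {b} (inj₁ _) (inj₂ cm) = inj₂ (refine cm (holds cm)
  (fails-∷ (λ s → fails cm (here refl) (proj₂ (sat-∧⁻ a b s))) (λ m → fails cm (there m))))

-- Leaves of the search: variables A and processed formulas K on the left,
-- variables B on the right.  If A and B meet, an axiom applies; otherwise the
-- valuation making A true and the other variables of the antecedent false
-- is a countermodel.
atomValuation : List Prop → List Prop → Valuation
atomValuation A S p with p ∈? A | p ∈? S
... | yes _ | _     = just true
... | no _  | yes _ = just false
... | no _  | no _  = nothing

leaf-countermodel : ∀ A K B → (∀ {p} → p ∈ B → p ∉ A) →
                    Countermodel (map var A) (varsL (map var A ++ K)) (map var B)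
leaf-countermodel A K B disjoint = record
  { val = v ; holds = holds-A ; fails = fails-B
  ; defined-on = defined-S ; undefined-off = undefined-outside }
  where
  S = varsL (map var A ++ K)
  v = atomValuation A S
  A⊆S : ∀ {p} → p ∈ A → p ∈ S
  A⊆S p∈A = varsL⁺ (∈-++⁺ˡ (∈-map⁺ var p∈A)) (here refl)
  holds-A : Holds v (map var A)
  holds-A m with ∈-map⁻ var m
  ... | p , p∈A , refl with p ∈? A
  ...   | yes _   = refl
  ...   | no p∉A = ⊥-elim (p∉A p∈A)
  fails-B : Fails v (map var B)
  fails-B m with ∈-map⁻ var m
  ... | p , p∈B , refl with p ∈? A | p ∈? S
  ...   | yes p∈A | _     = ⊥-elim (disjoint p∈B p∈A)
  ...   | no _    | yes _ = λ ()
  ...   | no _    | no _  = λ ()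
  defined-S : ∀ {p} → p ∈ S → Defined v (var p)
  defined-S {p} p∈S with p ∈? A | p ∈? S
  ... | yes _ | _       = true , refl
  ... | no _  | yes _   = false , refl
  ... | no _  | no p∉S = ⊥-elim (p∉S p∈S)
  undefined-outside : ∀ {p} → p ∉ S → v p ≡ nothing
  undefined-outside {p} p∉S with p ∈? A | p ∈? S
  ... | yes p∈A | _       = ⊥-elim (p∉S (A⊆S p∈A))
  ... | no _    | yes p∈S = ⊥-elim (p∉S p∈S)
  ... | no _    | no _    = refl

leaf : ∀ A K B → Outcome (map var A) (map var A ++ K) (map var B)
leaf A K B with common-or-disjoint B A
... | inj₁ (p , p∈B , p∈A) =
  inj₁ (weaken (ax {a = var p} ≈-refl ≈-refl)
          (singleton-⊆ (∈-++⁺ˡ (∈-map⁺ var p∈A))) (singleton-⊆ (∈-map⁺ var p∈B)))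
... | inj₂ disjoint = inj₂ (leaf-countermodel A K B disjoint)

size : Formula → ℕ
size (var p)  = 1
size (¬' a)   = suc (size a)
size (a ∧' b) = suc (size a + size b)

weight : List Formula → ℕ
weight []       = 0
weight (a ∷ Γ) = size a + weight Γ

weight-move : ∀ a L R → weight L + weight (a ∷ R) ≡ weight (a ∷ L) + weight R
weight-move a L R = begin
  weight L + (size a + weight R)   ≡⟨ sym (+-assoc (weight L) (size a) (weight R)) ⟩
  (weight L + size a) + weight R   ≡⟨ cong (_+ weight R) (+-comm (weight L) (size a)) ⟩
  (size a + weight L) + weight R   ∎
  where open ≡-Reasoning

decrease : ∀ {new old n} → new < old → old < suc n → new < n
decrease new<old old<1+n = <-≤-trans new<old (≤-pred old<1+n)

-- The search state: pending formulas L and R, variables A and processed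
-- negations K on the left, variables B on the right.  The left pending
-- formulas are decomposed first; the antecedent's variable set never changes.
-- The countermodel is asked to satisfy only L and A: the negations in K are
-- certified by `neg-left` when the search returns.
search : ∀ n A K L B R → weight L + weight R < n →
         Outcome (L ++ map var A) (L ++ map var A ++ K) (R ++ map var B)
search (suc n) A K (var p ∷ L) B R bound =
  outcome-resp (shift L) (shift L) ≈-refl
    (search n (p ∷ A) K L B R (decrease (n<1+n _) bound))
search (suc n) A K (¬' a ∷ L) B R bound =
  neg-left (here refl) (outcome-resp ≈-refl (shift₂ L (map var A)) ≈-refl
    (search n A (¬' a ∷ K) L B (a ∷ R) (decrease (s≤s (≤-reflexive (weight-move a L R))) bound)))
search (suc n) A K ((a ∧' b) ∷ L) B R bound =
  and-left (search n A K (a ∷ b ∷ L) B R (decrease (s≤s (≤-reflexive reassoc)) bound))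
  where
  reassoc : weight (a ∷ b ∷ L) + weight R ≡ (size a + size b + weight L) + weight R
  reassoc = cong (_+ weight R) (sym (+-assoc (size a) (size b) (weight L)))
search (suc n) A K [] B (var p ∷ R) bound =
  outcome-resp ≈-refl ≈-refl (shift R)
    (search n A K [] (p ∷ B) R (decrease (n<1+n _) bound))
search (suc n) A K [] B (¬' a ∷ R) bound with ⊆ᵛ-or-escapes (vars a) (varsL (map var A ++ K))
... | inj₁ covered =
  neg-right-covered covered
    (search n A K [ a ] B R (decrease (s≤s (≤-reflexive (sym (weight-move a [] R)))) bound))
... | inj₂ (p , p∈a , p∉Γ) =
  neg-right-escaping p∈a p∉Γ
    (search n A K [] B R (decrease (s≤s (m≤n+m (weight R) (size a))) bound))
search (suc n) A K [] B ((a ∧' b) ∷ R) bound =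
  and-right
    (search n A K [] B (a ∷ R) (decrease (s≤s (+-monoˡ-≤ (weight R) (m≤m+n (size a) (size b)))) bound))
    (search n A K [] B (b ∷ R) (decrease (s≤s (+-monoˡ-≤ (weight R) (m≤n+m (size b) (size a)))) bound))
search (suc n) A K [] B [] _ = leaf A K B

cut-free-or-countermodel : ∀ Γ Δ → Outcome Γ Γ Δ
cut-free-or-countermodel Γ Δ =
  subst₂ (λ X Y → Outcome X X Y) (++-identityʳ Γ) (++-identityʳ Δ)
    (search (suc (weight Γ + weight Δ)) [] [] Γ [] Δ (n<1+n _))

mainTheorem6 : (Γ Δ : List Formula) → NonEmptySeq Γ Δ →
    ⊢[ true ] Γ ⇒ Δ → ⊢[ false ] Γ ⇒ Δ
mainTheorem6 Γ Δ _ d with cut-free-or-countermodel Γ Δ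
... | inj₁ cutFree = cutFree
... | inj₂ cm      = ⊥-elim (sound d (val cm) (holds cm) (fails cm))
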